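{- Let $G=(X,Y;E)$ be a connected balanced bipartite graph with bipartition classes $X,Y$. If $\rho(x,y)\geq \rho$ for every $x\in X$ and $y\in Y$, then for any $x_0\in X$ and $y_0\in Y$, $G$ has a detached maximal $\{x_0,y_0\}$-DPP of order at least $\rho+1$.
   Context: Graphs are finite and simple; $N_G(v)$ is the neighborhood of $v$. A bipartite graph is balanced if $|X|=|Y|$. For $S\subseteq V(G)$, $\rho_G(S)$ is the number of edges of $G$ incident to at least one vertex of $S$, and $\rho(x,y):=\rho_G(\{x,y\})$. An $s$-path is a path with origin $s$ (possibly trivial); its other end is its terminus. An $\{s,s'\}$-disjoint path pair ($\{s,s'\}$-DPP) is the union $D$ of an $s$-path and an $s'$-path that are vertex-disjoint; if $t,t'$ are the termini of these two paths, $D$ is maximal if $N_G(t)\cup N_G(t')\subseteq V(D)$, and (for bipartite $G$) $D$ is detached if $t$ and $t'$ lie in different bipartition classes. The order of $D$ is $|V(D)|$. -}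

module Defs where

open import Data.Nat using (ℕ; zero; suc; _+_)
open import Data.Bool using (Bool; true; false; if_then_else_; _∧_; _∨_; T)
open import Data.Fin using (Fin; _≟_)
open import Data.Sum using (_⊎_; inj₁; inj₂)
open import Data.List using (List; []; _∷_; _++_; map; allFin; length)
open import Data.Nat.ListAction using (sum)
open import Data.List.Relation.Unary.Linked using (Linked)
open import Data.List.Relation.Unary.Unique.Propositional using (Unique)
open import Data.List.Membership.Propositional using (_∈_)
open import Data.Product using (Σ; _×_; ∃-syntax)
open import Data.Empty using (⊥)
open import Relation.Nullary.Decidable using (⌊_⌋)
open import Relation.Binary.PropositionalEquality using (_≡_; _≢_)

-- A balanced bipartite graph G = (X, Y; E) with |X| = |Y| = m:
-- X and Y are both copies of Fin m, and the edge set is given by a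
-- Boolean relation A : X → Y → Bool  (A x y = true iff xy ∈ E).
-- Being bipartite with classes X, Y, every edge joins X to Y; the graph
-- is automatically simple.
BipGraph : ℕ → Set
BipGraph m = Fin m → Fin m → Bool

-- Vertex set V(G) = X ⊎ Y  (inj₁ = vertices of X, inj₂ = vertices of Y).
Vertex : ℕ → Set
Vertex m = Fin m ⊎ Fin m

Adj : ∀ {m} → BipGraph m → Vertex m → Vertex m → Set
Adj A (inj₁ x) (inj₂ y) = T (A x y)
Adj A (inj₂ y) (inj₁ x) = T (A x y)
Adj A (inj₁ _) (inj₁ _) = ⊥
Adj A (inj₂ _) (inj₂ _) = ⊥

inX : ∀ {m} → Vertex m → Bool
inX (inj₁ _) = true
inX (inj₂ _) = false

lastOf : ∀ {a} {B : Set a} → B → List B → B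
lastOf s []       = s
lastOf s (p ∷ ps) = lastOf p ps

Connected : ∀ {m} → BipGraph m → Set
Connected {m} A = (u v : Vertex m) →
  ∃[ ps ] (Linked (Adj A) (u ∷ ps) × lastOf u ps ≡ v)

-- s ∷ ps is an s-path: consecutive vertices adjacent, vertices distinct.
-- Its terminus is lastOf s ps, its vertex set the list s ∷ ps.
IsPath : ∀ {m} → BipGraph m → Vertex m → List (Vertex m) → Set
IsPath A s ps = Linked (Adj A) (s ∷ ps) × Unique (s ∷ ps)

-- ρ(x,y) = ρ_G({x,y}): number of edges ab (a ∈ X, b ∈ Y) of G with
-- a = x or b = y, i.e. incident to at least one of x, y.
rho : ∀ {m} → BipGraph m → Fin m → Fin m → ℕ
rho {m} A x y =
  sum (map (λ a → sum (map (λ b →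
        if A a b ∧ (⌊ a ≟ x ⌋ ∨ ⌊ b ≟ y ⌋) then 1 else 0)
      (allFin m))) (allFin m))

-- An {s,s'}-DPP given by the s-path s ∷ ps and the s'-path s' ∷ qs,
-- which are vertex-disjoint (the union list is duplicate-free).
IsDPP : ∀ {m} → BipGraph m → Vertex m → Vertex m →
        List (Vertex m) → List (Vertex m) → Set
IsDPP A s s' ps qs =
  IsPath A s ps × IsPath A s' qs × Unique ((s ∷ ps) ++ (s' ∷ qs))

IsMaximal : ∀ {m} → BipGraph m → Vertex m → Vertex m →
            List (Vertex m) → List (Vertex m) → Set
IsMaximal {m} A s s' ps qs =
  ((w : Vertex m) → Adj A (lastOf s ps) w → w ∈ ((s ∷ ps) ++ (s' ∷ qs))) ×
  ((w : Vertex m) → Adj A (lastOf s' qs) w → w ∈ ((s ∷ ps) ++ (s' ∷ qs)))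

IsDetached : ∀ {m} → Vertex m → Vertex m →
             List (Vertex m) → List (Vertex m) → Set
IsDetached s s' ps qs = inX (lastOf s ps) ≢ inX (lastOf s' qs)

order : ∀ {a} {B : Set a} → B → B → List B → List B → ℕ
order s s' ps qs = length ((s ∷ ps) ++ (s' ∷ qs))

-- Let H be a set of vertices, r ∉ H, and U the component of r in G − H. For each
-- class c, either some maximal r-path of G − H ends outside c, or U has at least
-- [r ∈ c] more vertices in c than outside it. This follows along a depth-first
-- search: the subtrees hanging off r are components of G − H − r rooted at
-- neighbours of r, hence in the class opposite to r; a maximal path of a subtree
-- extends through r to a maximal path of G − H, and otherwise each subtree
-- contributes its surplus.
--
-- For roots x₀ ∈ X and y₀ ∈ Y the same induction, pairing the component of y₀ in
-- G − x₀ with the component of x₀ avoiding it (or first stepping from x₀ to a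
-- neighbour inside the former), yields either a detached maximal DPP or a class c
-- in which the union of the two components has one vertex more than outside c.
-- For connected G that union is V(G), contradicting |X| = |Y|.
--
-- If the termini are x ∈ X and y ∈ Y, every edge counted by ρ(x,y) has its
-- Y-end in D when it meets x, and its X-end in D ∖ {x} otherwise; these ends are
-- distinct, so ρ(x,y) ≤ |D| − 1.

module Submission where

open import Defs
open import Data.Bool using (Bool; true; false; not; T; if_then_else_; _∧_; _∨_)
open import Data.Bool.Properties using (T?; not-¬; ¬-not) renaming (_≟_ to _≟ᵇ_)
open import Data.Empty using (⊥; ⊥-elim)
open import Data.Fin using (Fin) renaming (_≟_ to _≟ᶠ_)
open import Data.List using (List; []; _∷_; _++_; map; allFin; length; filter)
open import Data.List.Properties using (length-++; length-map; length-tabulate)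
open import Data.List.Membership.Propositional using (_∈_; _∉_; lose)
open import Data.List.Membership.Propositional.Properties
  using (∈-++⁺ˡ; ∈-++⁺ʳ; ∈-++⁻; ∈-map⁺; ∈-map⁻; ∈-filter⁺; ∈-filter⁻; ∈-∃++; ∈-allFin)
open import Data.List.Relation.Binary.Subset.Propositional using (_⊆_)
open import Data.List.Relation.Binary.Subset.Propositional.Properties
  using (xs⊆x∷xs; xs⊆xs++ys; xs⊆ys++xs; ∷⁺ʳ)
open import Data.List.Relation.Unary.All as All using (All; []; _∷_)
open import Data.List.Relation.Unary.All.Properties using () renaming (++⁺ to All-++⁺)
open import Data.List.Relation.Unary.AllPairs using ([]; _∷_)
open import Data.List.Relation.Unary.Any using (here; there; any?; satisfied)
open import Data.List.Relation.Unary.Linked using (Linked; []; [-]; _∷_)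
open import Data.List.Relation.Unary.Unique.Propositional using (Unique)
import Data.List.Relation.Unary.Unique.Propositional.Properties as Unique
open import Data.Nat using (ℕ; zero; suc; _+_; _≤_; _<_; z≤n; s≤s)
open import Data.Nat.ListAction using (sum)
open import Data.Nat.Properties
open import Algebra.Properties.CommutativeSemigroup +-commutativeSemigroup using (interchange)
open import Data.Nat.Tactic.RingSolver using (solve-∀)
open import Data.Product using (∃-syntax; _×_; _,_; proj₁; proj₂)
open import Data.Sum using (_⊎_; inj₁; inj₂)
import Data.Sum as Sum
open import Data.Sum.Properties using (inj₁-injective; inj₂-injective; ≡-dec)
open import Function using (_$_; _∘_; id)
open import Relation.Binary.Definitions using (DecidableEquality)
open import Relation.Binary.PropositionalEquality
open import Relation.Nullary using (Dec; yes; no; ¬_; does)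
open import Relation.Nullary.Decidable using (⌊_⌋; ¬?; _×-dec_; decidable-stable)
open import Relation.Unary using (Decidable)

Unique-⊆⇒length≤ : ∀ {a} {B : Set a} {xs ys : List B} → Unique xs → xs ⊆ ys → length xs ≤ length ys
Unique-⊆⇒length≤ {xs = []} _ _ = z≤n
Unique-⊆⇒length≤ {xs = x ∷ xs} (x∉xs ∷ uxs) xs⊆ys with ∈-∃++ (xs⊆ys (here refl))
... | ys₁ , ys₂ , refl = begin
  suc (length xs)               ≤⟨ s≤s (Unique-⊆⇒length≤ uxs xs⊆ys₁++ys₂) ⟩
  suc (length (ys₁ ++ ys₂))     ≡⟨ cong suc (length-++ ys₁) ⟩
  suc (length ys₁ + length ys₂) ≡⟨ sym (+-suc (length ys₁) (length ys₂)) ⟩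
  length ys₁ + suc (length ys₂) ≡⟨ sym (length-++ ys₁) ⟩
  length (ys₁ ++ x ∷ ys₂)       ∎
  where
  open ≤-Reasoning
  xs⊆ys₁++ys₂ : xs ⊆ ys₁ ++ ys₂
  xs⊆ys₁++ys₂ {z} z∈xs with ∈-++⁻ ys₁ (xs⊆ys (there z∈xs))
  ... | inj₁ z∈ys₁        = ∈-++⁺ˡ z∈ys₁
  ... | inj₂ (here refl)  = ⊥-elim (All.lookup x∉xs z∈xs refl)
  ... | inj₂ (there z∈ys₂) = ∈-++⁺ʳ ys₁ z∈ys₂

lastOf-∈ : ∀ {a} {B : Set a} (s : B) ps → lastOf s ps ∈ s ∷ ps
lastOf-∈ s []       = here refl
lastOf-∈ s (p ∷ ps) = there (lastOf-∈ p ps)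

∈-∷⁻ : ∀ {a} {B : Set a} {x y : B} {xs} → x ∈ y ∷ xs → x ∈ y ∷ [] ⊎ x ∈ xs
∈-∷⁻ (here x≡y)   = inj₁ (here x≡y)
∈-∷⁻ (there x∈xs) = inj₂ x∈xs

∉-∷ : ∀ {a} {B : Set a} {x y : B} {ys} → x ≢ y → x ∉ ys → x ∉ y ∷ ys
∉-∷ x≢y _    (here x≡y)   = x≢y x≡y
∉-∷ _   x∉ys (there x∈ys) = x∉ys x∈ys

∉-++ : ∀ {a} {B : Set a} {x : B} {xs ys} → x ∉ xs → x ∉ ys → x ∉ xs ++ ys
∉-++ {xs = xs} x∉xs x∉ys x∈ = Sum.[ x∉xs , x∉ys ] (∈-++⁻ xs x∈)

avoids-⊆ : ∀ {a} {B : Set a} {H H′ U : List B} → H′ ⊆ H → All (_∉ H) U → All (_∉ H′) U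
avoids-⊆ H′⊆H = All.map (λ v∉H v∈H′ → v∉H (H′⊆H v∈H′))

avoids⇒≢ : ∀ {a} {B : Set a} {r : B} {H U} → All (_∉ r ∷ H) U → All (r ≢_) U
avoids⇒≢ = All.map (λ v∉ r≡v → v∉ (here (sym r≡v)))

module _ {a} {B : Set a} (_≟_ : DecidableEquality B) where

  open import Data.List.Membership.DecPropositional _≟_ using (_∈?_)

  #outside : List B → List B → ℕ
  #outside F xs = length (filter (λ v → ¬? (v ∈? F)) xs)

  #outside-antitone : ∀ {F G} xs → F ⊆ G → #outside G xs ≤ #outside F xs
  #outside-antitone []       F⊆G = z≤n
  #outside-antitone {F} {G} (v ∷ xs) F⊆G with v ∈? G | v ∈? F
  ... | yes _   | yes _  = #outside-antitone xs F⊆G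
  ... | yes _   | no _   = m≤n⇒m≤1+n (#outside-antitone xs F⊆G)
  ... | no v∉G  | yes v∈F = ⊥-elim (v∉G (F⊆G v∈F))
  ... | no _    | no _   = s≤s (#outside-antitone xs F⊆G)

  #outside-strict : ∀ {F G r} xs → F ⊆ G → r ∈ xs → r ∈ G → r ∉ F → #outside G xs < #outside F xs
  #outside-strict {F} {G} (v ∷ xs) F⊆G r∈ r∈G r∉F with v ∈? G | v ∈? F | r∈
  ... | _      | yes v∈F | here refl  = ⊥-elim (r∉F v∈F)
  ... | no v∉G | _       | here refl  = ⊥-elim (v∉G r∈G)
  ... | yes _  | no _    | here refl  = s≤s (#outside-antitone xs F⊆G)
  ... | yes _  | yes _   | there r∈xs = #outside-strict xs F⊆G r∈xs r∈G r∉F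
  ... | yes _  | no _    | there r∈xs = m≤n⇒m≤1+n (#outside-strict xs F⊆G r∈xs r∈G r∉F)
  ... | no v∉G | yes v∈F | there _    = ⊥-elim (v∉G (F⊆G v∈F))
  ... | no _   | no _    | there r∈xs = s≤s (#outside-strict xs F⊆G r∈xs r∈G r∉F)

∑ : ∀ {a} {B : Set a} → (B → ℕ) → List B → ℕ
∑ f xs = sum (map f xs)

𝟙 : ∀ {p} {P : Set p} → Dec P → ℕ
𝟙 P? = if does P? then 1 else 0

module _ {a} {B : Set a} where

  ∑-mono-≤ : ∀ {f g : B → ℕ} xs → (∀ x → f x ≤ g x) → ∑ f xs ≤ ∑ g xs
  ∑-mono-≤ []       f≤g = z≤n
  ∑-mono-≤ (x ∷ xs) f≤g = +-mono-≤ (f≤g x) (∑-mono-≤ xs f≤g)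

  ∑-+ : ∀ (f g : B → ℕ) xs → ∑ (λ x → f x + g x) xs ≡ ∑ f xs + ∑ g xs
  ∑-+ f g []       = refl
  ∑-+ f g (x ∷ xs) = begin
    f x + g x + ∑ (λ x → f x + g x) xs ≡⟨ cong (f x + g x +_) (∑-+ f g xs) ⟩
    f x + g x + (∑ f xs + ∑ g xs)       ≡⟨ interchange (f x) (g x) (∑ f xs) (∑ g xs) ⟩
    f x + ∑ f xs + (g x + ∑ g xs)       ∎
    where open ≡-Reasoning

  ∑-𝟙 : ∀ {p} {P : B → Set p} (P? : Decidable P) xs → ∑ (λ x → 𝟙 (P? x)) xs ≡ length (filter P? xs)
  ∑-𝟙 P? []       = refl
  ∑-𝟙 P? (x ∷ xs) with does (P? x)
  ... | true  = cong suc (∑-𝟙 P? xs)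
  ... | false = ∑-𝟙 P? xs

module _ {a} {B : Set a} (_≟_ : DecidableEquality B) where

  ∑-point : ∀ (i : B) K {js} → Unique js → ∑ (λ j → if ⌊ j ≟ i ⌋ then K else 0) js ≤ K
  ∑-point i K {[]}     _            = z≤n
  ∑-point i K {j ∷ js} (j∉js ∷ ujs) with j ≟ i
  ... | no _     = ∑-point i K ujs
  ... | yes refl = ≤-reflexive (trans (cong (K +_) (∑-zero js j∉js)) (+-identityʳ K))
    where
    ∑-zero : ∀ ks → All (j ≢_) ks → ∑ (λ k → if ⌊ k ≟ j ⌋ then K else 0) ks ≡ 0
    ∑-zero []       []            = refl
    ∑-zero (k ∷ ks) (j≢k ∷ j≢ks) with k ≟ j
    ... | yes refl = ⊥-elim (j≢k refl)
    ... | no _     = ∑-zero ks j≢ks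

module _ {m} (A : BipGraph m) {D : List (Vertex m)} (uniqueD : Unique D) {x y : Fin m}
         (x∈D : inj₁ x ∈ D)
         (N[x]⊆D : ∀ w → Adj A (inj₁ x) w → w ∈ D)
         (N[y]⊆D : ∀ w → Adj A (inj₂ y) w → w ∈ D) where

  private
    open import Data.List.Membership.DecPropositional (≡-dec (_≟ᶠ_ {m}) (_≟ᶠ_ {m})) using (_∈?_)

    inY? : Decidable (λ b → inj₂ b ∈ D)
    inY? b = inj₂ b ∈? D

    inX∖x? : Decidable (λ a → a ≢ x × inj₁ a ∈ D)
    inX∖x? a = ¬? (a ≟ᶠ x) ×-dec (inj₁ a ∈? D)

    Ys Xs : List (Fin m)
    Ys = filter inY? (allFin m)
    Xs = filter inX∖x? (allFin m)

    row : Fin m → ℕ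
    row a = ∑ (λ b → if A a b ∧ (⌊ a ≟ᶠ x ⌋ ∨ ⌊ b ≟ᶠ y ⌋) then 1 else 0) (allFin m)

    row≤ : ∀ a → row a ≤ (if ⌊ a ≟ᶠ x ⌋ then length Ys else 0) + 𝟙 (inX∖x? a)
    row≤ a with a ≟ᶠ x
    ... | yes refl =
      ≤-trans (∑-mono-≤ (allFin m) edge≤) (≤-trans (≤-reflexive (∑-𝟙 inY? (allFin m))) (m≤m+n _ _))
      where
      edge≤ : ∀ b → (if A x b ∧ true then 1 else 0) ≤ 𝟙 (inY? b)
      edge≤ b with A x b in xb | inY? b
      ... | false | _      = z≤n
      ... | true  | yes _  = ≤-refl
      ... | true  | no b∉D = ⊥-elim (b∉D (N[x]⊆D (inj₂ b) (subst T (sym xb) _)))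
    ... | no _ = ≤-trans (∑-mono-≤ (allFin m) edge≤) (∑-point _≟ᶠ_ y _ (Unique.allFin⁺ m))
      where
      edge≤ : ∀ b → (if A a b ∧ ⌊ b ≟ᶠ y ⌋ then 1 else 0) ≤
                    (if ⌊ b ≟ᶠ y ⌋ then 𝟙 (inj₁ a ∈? D) else 0)
      edge≤ b with A a b in ab | b ≟ᶠ y
      ... | false | _     = z≤n
      ... | true  | no _  = z≤n
      ... | true  | yes refl with inj₁ a ∈? D
      ...   | yes _  = ≤-refl
      ...   | no a∉D = ⊥-elim (a∉D (N[y]⊆D (inj₁ a) (subst T (sym ab) _)))

    rho≤ : rho A x y ≤ length Ys + length Xs
    rho≤ = begin
      rho A x y
        ≤⟨ ∑-mono-≤ (allFin m) row≤ ⟩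
      ∑ (λ a → (if ⌊ a ≟ᶠ x ⌋ then length Ys else 0) + 𝟙 (inX∖x? a)) (allFin m)
        ≡⟨ ∑-+ _ _ (allFin m) ⟩
      ∑ (λ a → if ⌊ a ≟ᶠ x ⌋ then length Ys else 0) (allFin m) + ∑ (λ a → 𝟙 (inX∖x? a)) (allFin m)
        ≤⟨ +-mono-≤ (∑-point _≟ᶠ_ x _ (Unique.allFin⁺ m)) (≤-reflexive (∑-𝟙 inX∖x? (allFin m))) ⟩
      length Ys + length Xs
        ∎
      where open ≤-Reasoning

    W : List (Vertex m)
    W = inj₁ x ∷ map inj₁ Xs ++ map inj₂ Ys

    uniqueW : Unique W
    uniqueW = All.tabulate x≢ ∷
      Unique.++⁺ (Unique.map⁺ inj₁-injective (Unique.filter⁺ inX∖x? (Unique.allFin⁺ m)))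
                 (Unique.map⁺ inj₂-injective (Unique.filter⁺ inY? (Unique.allFin⁺ m)))
                 X∩Y=∅
      where
      X∩Y=∅ : ∀ {v} → ¬ (v ∈ map inj₁ Xs × v ∈ map inj₂ Ys)
      X∩Y=∅ (v∈X , v∈Y) with ∈-map⁻ inj₁ v∈X | ∈-map⁻ inj₂ v∈Y
      ... | _ , _ , refl | _ , _ , ()
      x≢ : ∀ {v} → v ∈ map inj₁ Xs ++ map inj₂ Ys → inj₁ x ≢ v
      x≢ v∈ refl with ∈-++⁻ (map inj₁ Xs) v∈
      ... | inj₁ x∈X with ∈-map⁻ inj₁ x∈X
      ...   | _ , x∈Xs , refl = proj₁ (proj₂ (∈-filter⁻ inX∖x? {xs = allFin m} x∈Xs)) refl
      x≢ v∈ refl | inj₂ x∈Y with ∈-map⁻ inj₂ x∈Y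
      ...   | _ , _ , ()

    W⊆D : W ⊆ D
    W⊆D (here refl) = x∈D
    W⊆D (there v∈) with ∈-++⁻ (map inj₁ Xs) v∈
    ... | inj₁ v∈X with ∈-map⁻ inj₁ v∈X
    ...   | _ , a∈Xs , refl = proj₂ (proj₂ (∈-filter⁻ inX∖x? {xs = allFin m} a∈Xs))
    W⊆D (there v∈) | inj₂ v∈Y with ∈-map⁻ inj₂ v∈Y
    ...   | _ , b∈Ys , refl = proj₂ (∈-filter⁻ inY? {xs = allFin m} b∈Ys)

  rho<length : rho A x y < length D
  rho<length = begin-strict
    rho A x y                                       ≤⟨ rho≤ ⟩
    length Ys + length Xs                           ≡⟨ +-comm (length Ys) (length Xs) ⟩
    length Xs + length Ys                           ≡⟨ sym (cong₂ _+_ (length-map inj₁ Xs) (length-map inj₂ Ys)) ⟩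
    length (map inj₁ Xs) + length (map inj₂ Ys)     ≡⟨ sym (length-++ (map inj₁ Xs)) ⟩
    length (map inj₁ Xs ++ map inj₂ Ys)             <⟨ Unique-⊆⇒length≤ uniqueW W⊆D ⟩
    length D                                        ∎
    where open ≤-Reasoning

+-cycle-absurd : ∀ {a b x y} → x + y ≡ 1 → a + x ≤ b → b + y ≤ a → ⊥
+-cycle-absurd {a} {b} {x} {y} x+y≡1 a+x≤b b+y≤a = m+1+n≰m a (begin
  a + 1       ≡⟨ cong (a +_) (sym x+y≡1) ⟩
  a + (x + y) ≡⟨ sym (+-assoc a x y) ⟩
  a + x + y   ≤⟨ +-monoˡ-≤ y a+x≤b ⟩
  b + y       ≤⟨ b+y≤a ⟩
  a           ∎)
  where open ≤-Reasoning

opposite-or-common : ∀ {p q r s} {P : Bool → Set p} {Q : Bool → Set q} {R : Bool → Set r} {S : Bool → Set s} →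
  (∀ c → P (not c) ⊎ R c) → (∀ c → Q (not c) ⊎ S c) →
  (∀ c → R c → R (not c) → ⊥) → (∀ c → S c → S (not c) → ⊥) →
  (∃[ e ] P e × Q (not e)) ⊎ (∃[ c ] R c × S c)
opposite-or-common P⊎R Q⊎S ¬R² ¬S² with P⊎R true | Q⊎S true | P⊎R false | Q⊎S false
... | inj₂ r | inj₂ s | _      | _      = inj₂ (true , r , s)
... | _      | _      | inj₂ r | inj₂ s = inj₂ (false , r , s)
... | inj₁ p | _      | _      | inj₁ q = inj₁ (false , p , q)
... | _      | inj₁ q | inj₁ p | _      = inj₁ (true , p , q)
... | inj₂ r | _      | inj₂ r′ | _     = ⊥-elim (¬R² true r r′)
... | _      | inj₂ s | _      | inj₂ s′ = ⊥-elim (¬S² true s s′)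

δ : Bool → Bool → ℕ
δ true  true  = 1
δ false false = 1
δ _     _     = 0

δ-not : ∀ c i → δ (not c) i ≡ δ c (not i)
δ-not true  true  = refl
δ-not true  false = refl
δ-not false true  = refl
δ-not false false = refl

δ-refl : ∀ c → δ c c ≡ 1
δ-refl true  = refl
δ-refl false = refl

δ-≢ : ∀ {c i} → i ≢ c → δ c i ≡ 0
δ-≢ {true}  {true}  i≢c = ⊥-elim (i≢c refl)
δ-≢ {true}  {false} _   = refl
δ-≢ {false} {true}  _   = refl
δ-≢ {false} {false} i≢c = ⊥-elim (i≢c refl)

δ-opposite : ∀ c → δ c true + δ c false ≡ 1
δ-opposite true  = refl
δ-opposite false = refl

δ-partition : ∀ c i → δ c i + δ (not c) i ≡ 1
δ-partition true  true  = refl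
δ-partition true  false = refl
δ-partition false true  = refl
δ-partition false false = refl

module _ {m : ℕ} where

  count : Bool → List (Vertex m) → ℕ
  count c []      = 0
  count c (v ∷ U) = δ c (inX v) + count c U

  count-++ : ∀ c U W → count c (U ++ W) ≡ count c U + count c W
  count-++ c []      W = refl
  count-++ c (v ∷ U) W = trans (cong (δ c (inX v) +_) (count-++ c U W)) (sym (+-assoc (δ c (inX v)) _ _))

  record Heavy (c : Bool) (U : List (Vertex m)) (k : ℕ) : Set where
    constructor heavy
    field
      bound : count (not c) U + k ≤ count c U

  Heavy-weaken : ∀ {c U k k′} → k′ ≤ k → Heavy c U k → Heavy c U k′
  Heavy-weaken {c} {U} k′≤k (heavy bound) = heavy (≤-trans (+-monoʳ-≤ (count (not c) U) k′≤k) bound)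

  Heavy-++ : ∀ {c U W k l} → Heavy c U k → Heavy c W l → Heavy c (U ++ W) (k + l)
  Heavy-++ {c} {U} {W} {k} {l} (heavy U-heavy) (heavy W-heavy) = heavy $ begin
    count (not c) (U ++ W) + (k + l)                  ≡⟨ cong (_+ (k + l)) (count-++ (not c) U W) ⟩
    count (not c) U + count (not c) W + (k + l)       ≡⟨ interchange (count (not c) U) _ k l ⟩
    (count (not c) U + k) + (count (not c) W + l)     ≤⟨ +-mono-≤ U-heavy W-heavy ⟩
    count c U + count c W                             ≡⟨ sym (count-++ c U W) ⟩
    count c (U ++ W)                                  ∎
    where open ≤-Reasoning

  Heavy-∷ : ∀ {c U k} v → Heavy c U (k + δ c (not (inX v))) → Heavy c (v ∷ U) (δ c (inX v) + k)
  Heavy-∷ {c} {U} {k} v (heavy U-heavy) = heavy $ begin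
    δ (not c) (inX v) + count (not c) U + (δ c (inX v) + k)
      ≡⟨ cong (λ d → d + count (not c) U + (δ c (inX v) + k)) (δ-not c (inX v)) ⟩
    δ c (not (inX v)) + count (not c) U + (δ c (inX v) + k)
      ≡⟨ rearrange (δ c (not (inX v))) (count (not c) U) (δ c (inX v)) k ⟩
    δ c (inX v) + (count (not c) U + (k + δ c (not (inX v))))
      ≤⟨ +-monoʳ-≤ (δ c (inX v)) U-heavy ⟩
    δ c (inX v) + count c U
      ∎
    where
    open ≤-Reasoning
    rearrange : ∀ p n q k → p + n + (q + k) ≡ q + (n + (k + p))
    rearrange = solve-∀

  Heavy-[-] : ∀ v → Heavy (inX v) (v ∷ []) (δ (inX v) (inX v))
  Heavy-[-] v = heavy (singleton-bound (inX v))
    where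
    singleton-bound : ∀ i → δ (not i) i + 0 + δ i i ≤ δ i i + 0
    singleton-bound true  = ≤-refl
    singleton-bound false = ≤-refl

  ¬Heavy-both : ∀ c i {U} → Heavy c U (δ c i) → Heavy (not c) U (δ (not c) i) → ⊥
  ¬Heavy-both true  i (heavy c-heavy) (heavy ¬c-heavy) = +-cycle-absurd (δ-partition true i) c-heavy ¬c-heavy
  ¬Heavy-both false i (heavy c-heavy) (heavy ¬c-heavy) = +-cycle-absurd (δ-partition false i) c-heavy ¬c-heavy

  _≟ᵥ_ : DecidableEquality (Vertex m)
  _≟ᵥ_ = ≡-dec _≟ᶠ_ _≟ᶠ_

  vertices : List (Vertex m)
  vertices = map inj₁ (allFin m) ++ map inj₂ (allFin m)

  ∈-vertices : ∀ v → v ∈ vertices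
  ∈-vertices (inj₁ x) = ∈-++⁺ˡ (∈-map⁺ inj₁ (∈-allFin x))
  ∈-vertices (inj₂ y) = ∈-++⁺ʳ (map inj₁ (allFin m)) (∈-map⁺ inj₂ (∈-allFin y))

  unvisited : List (Vertex m) → ℕ
  unvisited H = #outside _≟ᵥ_ H vertices

  unvisited-antitone : ∀ {H H′} → H ⊆ H′ → unvisited H′ ≤ unvisited H
  unvisited-antitone = #outside-antitone _≟ᵥ_ vertices

  unvisited-∷ : ∀ {H r} → r ∉ H → unvisited (r ∷ H) < unvisited H
  unvisited-∷ {H} {r} = #outside-strict _≟ᵥ_ vertices (xs⊆x∷xs H r) (∈-vertices r) (here refl)

  unvisited-empty : ∀ {H r} → unvisited H ≤ 0 → r ∉ H → ⊥
  unvisited-empty H≤0 r∉H = n≮0 (≤-trans (unvisited-∷ r∉H) H≤0)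

  classMembers : Bool → List (Vertex m)
  classMembers true  = map inj₁ (allFin m)
  classMembers false = map inj₂ (allFin m)

  ∈-classMembers : ∀ v → v ∈ classMembers (inX v)
  ∈-classMembers (inj₁ x) = ∈-map⁺ inj₁ (∈-allFin x)
  ∈-classMembers (inj₂ y) = ∈-map⁺ inj₂ (∈-allFin y)

  classMembers⇒class : ∀ {c v} → v ∈ classMembers c → inX v ≡ c
  classMembers⇒class {true}  v∈ with ∈-map⁻ inj₁ v∈
  ... | _ , _ , refl = refl
  classMembers⇒class {false} v∈ with ∈-map⁻ inj₂ v∈
  ... | _ , _ , refl = refl

  classMembers-unique : ∀ c → Unique (classMembers c)
  classMembers-unique true  = Unique.map⁺ inj₁-injective (Unique.allFin⁺ m)
  classMembers-unique false = Unique.map⁺ inj₂-injective (Unique.allFin⁺ m)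

  length-classMembers : ∀ c → length (classMembers c) ≡ m
  length-classMembers true  = trans (length-map inj₁ (allFin m)) (length-tabulate id)
  length-classMembers false = trans (length-map inj₂ (allFin m)) (length-tabulate id)

  count≡length-filter : ∀ c U → count c U ≡ length (filter (λ v → inX v ≟ᵇ c) U)
  count≡length-filter c []      = refl
  count≡length-filter c (v ∷ U) with inX v ≟ᵇ c
  ... | yes refl = cong₂ _+_ (δ-refl (inX v)) (count≡length-filter c U)
  ... | no v∉c   = cong₂ _+_ (δ-≢ v∉c) (count≡length-filter c U)

  count-complete : ∀ {U} → Unique U → (∀ v → v ∈ U) → ∀ c → count c U ≡ m
  count-complete {U} unique complete c = begin-equality
    count c U                   ≡⟨ count≡length-filter c U ⟩
    length (filter inClass? U)  ≡⟨ ≤-antisym (Unique-⊆⇒length≤ (Unique.filter⁺ inClass? unique) filter⊆class)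
                                             (Unique-⊆⇒length≤ (classMembers-unique c) class⊆filter) ⟩
    length (classMembers c)     ≡⟨ length-classMembers c ⟩
    m                           ∎
    where
    open ≤-Reasoning
    inClass? : Decidable (λ v → inX v ≡ c)
    inClass? v = inX v ≟ᵇ c
    filter⊆class : filter inClass? U ⊆ classMembers c
    filter⊆class {v} v∈ =
      subst (λ c → v ∈ classMembers c) (proj₂ (∈-filter⁻ inClass? {xs = U} v∈)) (∈-classMembers v)
    class⊆filter : classMembers c ⊆ filter inClass? U
    class⊆filter {v} v∈ = ∈-filter⁺ inClass? (complete v) (classMembers⇒class v∈)

  ¬Heavy-complete : ∀ {c U k} → Unique U → (∀ v → v ∈ U) → Heavy c U k → 0 < k → ⊥
  ¬Heavy-complete {c} {k = suc k} unique complete (heavy bound) _ =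
    m+1+n≰m m (subst₂ (λ p q → p + suc k ≤ q) (count-complete unique complete (not c))
                                             (count-complete unique complete c) bound)

module _ {m : ℕ} (A : BipGraph m) where

  private
    V : Set
    V = Vertex m

  open import Data.List.Membership.DecPropositional (_≟ᵥ_ {m}) using (_∈?_)

  Adj? : ∀ u v → Dec (Adj A u v)
  Adj? (inj₁ x) (inj₂ y) = T? (A x y)
  Adj? (inj₂ y) (inj₁ x) = T? (A x y)
  Adj? (inj₁ _) (inj₁ _) = no λ ()
  Adj? (inj₂ _) (inj₂ _) = no λ ()

  Adj-sym : ∀ {u v} → Adj A u v → Adj A v u
  Adj-sym {inj₁ _} {inj₂ _} uv = uv
  Adj-sym {inj₂ _} {inj₁ _} uv = uv

  Adj-flips : ∀ {u v} → Adj A u v → inX v ≡ not (inX u)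
  Adj-flips {inj₁ _} {inj₂ _} _ = refl
  Adj-flips {inj₂ _} {inj₁ _} _ = refl

  Adj-irrefl : ∀ {u v} → Adj A u v → u ≢ v
  Adj-irrefl {inj₁ _} {inj₂ _} _ ()
  Adj-irrefl {inj₂ _} {inj₁ _} _ ()

  neighbour-outside? : ∀ G r → (∃[ w ] Adj A r w × w ∉ G) ⊎ (∀ {w} → Adj A r w → w ∈ G)
  neighbour-outside? G r with any? (λ w → Adj? r w ×-dec ¬? (w ∈? G)) vertices
  ... | yes found = inj₁ (satisfied found)
  ... | no none   = inj₂ λ {w} rw → decidable-stable (w ∈? G) λ w∉G → none (lose (∈-vertices w) (rw , w∉G))

  Closed : List V → List V → Set
  Closed H U = ∀ {u v} → u ∈ U → Adj A u v → v ∈ U ⊎ v ∈ H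

  Closed-⊆ : ∀ {H H′ U} → H ⊆ H′ → Closed H U → Closed H′ U
  Closed-⊆ H⊆H′ closed u∈U uv = Sum.map₂ H⊆H′ (closed u∈U uv)

  Closed-++ : ∀ {H U W} → Closed (W ++ H) U → Closed (U ++ H) W → Closed H (U ++ W)
  Closed-++ {H} {U} {W} U-closed W-closed u∈ uv = Sum.[
      (λ u∈U → regroup (xs⊆xs++ys U W) (xs⊆ys++xs W U) (U-closed u∈U uv)) ,
      (λ u∈W → regroup (xs⊆ys++xs W U) (xs⊆xs++ys U W) (W-closed u∈W uv)) ] (∈-++⁻ U u∈)
    where
    regroup : ∀ {X Y v} → X ⊆ U ++ W → Y ⊆ U ++ W → v ∈ X ⊎ v ∈ Y ++ H → v ∈ U ++ W ⊎ v ∈ H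
    regroup X⊆ _ (inj₁ v∈X) = inj₁ (X⊆ v∈X)
    regroup {Y = Y} _ Y⊆ (inj₂ v∈Y++H) = Sum.map₁ Y⊆ (∈-++⁻ Y v∈Y++H)

  walk⊆ : ∀ {H U u ps} → Closed H U → u ∈ U → Linked (Adj A) (u ∷ ps) → All (_∉ H) ps → u ∷ ps ⊆ U
  walk⊆ closed u∈U _ _ (here refl) = u∈U
  walk⊆ {ps = p ∷ ps} closed u∈U (up ∷ linked) (p∉H ∷ ps∉H) (there x∈) with closed u∈U up
  ... | inj₁ p∈U = walk⊆ closed p∈U linked ps∉H x∈
  ... | inj₂ p∈H = ⊥-elim (p∉H p∈H)

  AvoidingPath : List V → V → List V → Set
  AvoidingPath H r ps = Linked (Adj A) (r ∷ ps) × Unique (r ∷ ps) × All (_∉ H) (r ∷ ps)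

  MaximalIn : List V → V → List V → Set
  MaximalIn H r ps = ∀ w → Adj A (lastOf r ps) w → w ∈ r ∷ ps ⊎ w ∈ H

  MaxPath : List V → V → Bool → Set
  MaxPath H r e = ∃[ ps ] AvoidingPath H r ps × MaximalIn H r ps × inX (lastOf r ps) ≡ e

  AvoidingPath-⊆ : ∀ {H H′ r ps} → H′ ⊆ H → AvoidingPath H r ps → AvoidingPath H′ r ps
  AvoidingPath-⊆ H′⊆H (linked , unique , avoids) = linked , unique , avoids-⊆ H′⊆H avoids

  AvoidingPath-∷ : ∀ {H r v ps} → r ∉ H → Adj A r v → AvoidingPath (r ∷ H) v ps → AvoidingPath H r (v ∷ ps)
  AvoidingPath-∷ r∉H rv (linked , unique , avoids) =
    rv ∷ linked , avoids⇒≢ avoids ∷ unique , r∉H ∷ avoids-⊆ there avoids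

  MaxPath-∷ : ∀ {H F r v e} → r ∉ H → Adj A r v → Closed (r ∷ H) F →
              MaxPath (r ∷ F ++ H) v e → MaxPath H r e
  MaxPath-∷ {H} {F} {r} {v} r∉H rv F-closed (ps , path@(_ , _ , avoids) , maximal , ends) =
    v ∷ ps , AvoidingPath-∷ r∉H rv (AvoidingPath-⊆ (∷⁺ʳ r (xs⊆ys++xs H F)) path) , maximal′ , ends
    where
    t∉ : lastOf v ps ∉ r ∷ F ++ H
    t∉ = All.lookup avoids (lastOf-∈ v ps)
    maximal′ : MaximalIn H r (v ∷ ps)
    maximal′ w tw with maximal w tw
    ... | inj₁ w∈path       = inj₁ (there w∈path)
    ... | inj₂ (here refl)  = inj₁ (here refl)
    ... | inj₂ (there w∈F++H) with ∈-++⁻ F w∈F++H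
    ...   | inj₂ w∈H = inj₂ w∈H
    ...   | inj₁ w∈F with F-closed w∈F (Adj-sym {lastOf v ps} tw)
    ...     | inj₁ t∈F   = ⊥-elim (t∉ (there (∈-++⁺ˡ t∈F)))
    ...     | inj₂ t∈r∷H = ⊥-elim (t∉ (∷⁺ʳ r (xs⊆ys++xs H F) t∈r∷H))

  record Component (H : List V) (r : V) : Set where
    field
      U              : List V
      unique         : Unique U
      root∈          : r ∈ U
      avoids         : All (_∉ H) U
      closed         : Closed H U
      least          : ∀ {U′} → Closed H U′ → r ∈ U′ → U ⊆ U′
      maxPathOrHeavy : ∀ c → MaxPath H r (not c) ⊎ Heavy c U (δ c (inX r))

  -- F is the union of the components of G − H − r explored so far from r, and
  -- j c the surplus of class c that they are known to provide.
  record Forest (H : List V) (r : V) (j : Bool → ℕ) (F : List V) : Set where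
    field
      unique         : Unique F
      avoids         : All (_∉ r ∷ H) F
      closed         : Closed (r ∷ H) F
      least          : ∀ {U′} → Closed H U′ → r ∈ U′ → F ⊆ U′
      maxPathOrHeavy : ∀ c → MaxPath H r (not c) ⊎ Heavy c F (j c)

  open Component using (U)

  Forest-[] : ∀ {H r} → Forest H r (λ _ → 0) []
  Forest-[] = record
    { unique = [] ; avoids = [] ; closed = λ () ; least = λ _ _ () ; maxPathOrHeavy = λ _ → inj₂ (heavy z≤n) }

  Forest-weaken : ∀ {H r j j′ F} → (∀ c → j′ c ≤ j c) → Forest H r j F → Forest H r j′ F
  Forest-weaken j′≤j forest = record
    { Forest forest
    ; maxPathOrHeavy = λ c → Sum.map₂ (Heavy-weaken (j′≤j c)) (Forest.maxPathOrHeavy forest c) }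

  graft : ∀ {H r v j F} → r ∉ H → Adj A r v → v ∉ H → Forest H r j F →
          (C : Component (r ∷ F ++ H) v) → Forest H r (λ c → j c + δ c (inX v)) (F ++ U C)
  graft {H} {r} {v} {j} {F} r∉H rv v∉H forest C = record
    { unique = Unique.++⁺ (Forest.unique forest) (Component.unique C)
                 λ (x∈F , x∈C) → All.lookup (Component.avoids C) x∈C (there (∈-++⁺ˡ x∈F))
    ; avoids = All-++⁺ (Forest.avoids forest) (avoids-⊆ H⊆ (Component.avoids C))
    ; closed = Closed-++ (Closed-⊆ (xs⊆ys++xs (r ∷ H) (U C)) (Forest.closed forest))
                         (Closed-⊆ reorder (Component.closed C))
    ; least = least
    ; maxPathOrHeavy = maxPathOrHeavy }
    where
    H⊆ : r ∷ H ⊆ r ∷ F ++ H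
    H⊆ = ∷⁺ʳ r (xs⊆ys++xs H F)
    reorder : r ∷ F ++ H ⊆ F ++ r ∷ H
    reorder (here refl) = ∈-++⁺ʳ F (here refl)
    reorder (there x∈F++H) with ∈-++⁻ F x∈F++H
    ... | inj₁ x∈F = ∈-++⁺ˡ x∈F
    ... | inj₂ x∈H = ∈-++⁺ʳ F (there x∈H)
    least : ∀ {U′} → Closed H U′ → r ∈ U′ → F ++ U C ⊆ U′
    least {U′} U′-closed r∈U′ x∈ with ∈-++⁻ F x∈
    ... | inj₁ x∈F = Forest.least forest U′-closed r∈U′ x∈F
    ... | inj₂ x∈C = Component.least C (Closed-⊆ (λ h → there (∈-++⁺ʳ F h)) U′-closed) v∈U′ x∈C
      where
      v∈U′ : v ∈ U′
      v∈U′ with U′-closed r∈U′ rv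
      ... | inj₁ v∈U′ = v∈U′
      ... | inj₂ v∈H  = ⊥-elim (v∉H v∈H)
    maxPathOrHeavy : ∀ c → MaxPath H r (not c) ⊎ Heavy c (F ++ U C) (j c + δ c (inX v))
    maxPathOrHeavy c with Forest.maxPathOrHeavy forest c | Component.maxPathOrHeavy C c
    ... | inj₁ P       | _           = inj₁ P
    ... | inj₂ _       | inj₁ P      = inj₁ (MaxPath-∷ r∉H rv (Forest.closed forest) P)
    ... | inj₂ F-heavy | inj₂ C-heavy = inj₂ (Heavy-++ F-heavy C-heavy)

  Forest⇒Component : ∀ {H r F} → r ∉ H → Forest H r (λ c → δ c (not (inX r))) F →
                     (∀ {v} → Adj A r v → v ∈ r ∷ F ++ H) → Component H r
  Forest⇒Component {r = r} {F} r∉H forest N[r]⊆ = record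
    { U = r ∷ F
    ; unique = avoids⇒≢ (Forest.avoids forest) ∷ Forest.unique forest
    ; root∈ = here refl
    ; avoids = r∉H ∷ avoids-⊆ there (Forest.avoids forest)
    ; closed = Closed-++ (λ { (here refl) rv → ∈-∷⁻ (N[r]⊆ rv) }) (Forest.closed forest)
    ; least = λ { U′-closed r∈U′ (here refl) → r∈U′
                ; U′-closed r∈U′ (there x∈F) → Forest.least forest U′-closed r∈U′ x∈F }
    ; maxPathOrHeavy = λ c → Sum.map₂ (λ F-heavy → Heavy-weaken (m≤m+n _ 0) (Heavy-∷ r F-heavy))
                                      (Forest.maxPathOrHeavy forest c) }

  leaf : ∀ {H r} → r ∉ H → (∀ {v} → Adj A r v → v ∈ H) → Component H r
  leaf {H} {r} r∉H N[r]⊆H = record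
    { U = r ∷ []
    ; unique = [] ∷ []
    ; root∈ = here refl
    ; avoids = r∉H ∷ []
    ; closed = λ { (here refl) rv → inj₂ (N[r]⊆H rv) }
    ; least = λ { _ r∈U′ (here refl) → r∈U′ }
    ; maxPathOrHeavy = maxPathOrHeavy }
    where
    maxPathOrHeavy : ∀ c → MaxPath H r (not c) ⊎ Heavy c (r ∷ []) (δ c (inX r))
    maxPathOrHeavy c with inX r ≟ᵇ c
    ... | yes refl = inj₂ (Heavy-[-] r)
    ... | no r∉c   = inj₁ ([] , ([-] , [] ∷ [] , r∉H ∷ []) , (λ _ rw → inj₂ (N[r]⊆H rw)) , ¬-not r∉c)

  explore : ∀ n {H r j F} → (∀ {G v} → unvisited G ≤ n → v ∉ G → Component G v) →
            unvisited (r ∷ F ++ H) ≤ n → r ∉ H → Forest H r j F →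
            ∃[ F′ ] Forest H r j F′ × (∀ {v} → Adj A r v → v ∈ r ∷ F′ ++ H)
  explore zero {H} {r} {F = F} _ bound _ forest with neighbour-outside? (r ∷ F ++ H) r
  ... | inj₂ N[r]⊆        = F , forest , N[r]⊆
  ... | inj₁ (v , _ , v∉) = ⊥-elim (unvisited-empty bound v∉)
  explore (suc n) {H} {r} {j} {F} componentOf bound r∉H forest with neighbour-outside? (r ∷ F ++ H) r
  ... | inj₂ N[r]⊆         = F , forest , N[r]⊆
  ... | inj₁ (v , rv , v∉) =
    explore n (componentOf ∘ m≤n⇒m≤1+n) bound′ r∉H
            (Forest-weaken (λ c → m≤m+n (j c) _) (graft r∉H rv (v∉ ∘ there ∘ ∈-++⁺ʳ F) forest C))
    where
    C : Component (r ∷ F ++ H) v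
    C = componentOf bound v∉
    grown : v ∷ r ∷ F ++ H ⊆ r ∷ (F ++ U C) ++ H
    grown (here refl) = there (∈-++⁺ˡ (∈-++⁺ʳ F (Component.root∈ C)))
    grown (there (here refl)) = here refl
    grown (there (there x∈F++H)) with ∈-++⁻ F x∈F++H
    ... | inj₁ x∈F = there (∈-++⁺ˡ (∈-++⁺ˡ x∈F))
    ... | inj₂ x∈H = there (∈-++⁺ʳ (F ++ U C) x∈H)
    bound′ : unvisited (r ∷ (F ++ U C) ++ H) ≤ n
    bound′ = ≤-pred (≤-trans (s≤s (unvisited-antitone grown)) (≤-trans (unvisited-∷ v∉) bound))

  component′ : ∀ k {H r} → unvisited H ≤ k → r ∉ H → Component H r
  component′ zero    H≤0 r∉H = ⊥-elim (unvisited-empty H≤0 r∉H)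
  component′ (suc k) {H} {r} H≤1+k r∉H with neighbour-outside? H r
  ... | inj₂ N[r]⊆H         = leaf r∉H N[r]⊆H
  ... | inj₁ (w , rw , w∉H) with explore k (component′ k) r∷C++H≤k r∉H first
    where
    r∷H≤k : unvisited (r ∷ H) ≤ k
    r∷H≤k = ≤-pred (≤-trans (unvisited-∷ r∉H) H≤1+k)
    C : Component (r ∷ H) w
    C = component′ k r∷H≤k (∉-∷ (Adj-irrefl rw ∘ sym) w∉H)
    r∷C++H≤k : unvisited (r ∷ U C ++ H) ≤ k
    r∷C++H≤k = ≤-trans (unvisited-antitone (∷⁺ʳ r (xs⊆ys++xs H (U C)))) r∷H≤k
    first : Forest H r (λ c → δ c (not (inX r))) (U C)
    first = Forest-weaken (λ c → ≤-reflexive (cong (δ c) (sym (Adj-flips {r} rw))))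
                          (graft r∉H rw w∉H Forest-[] C)
  ...   | F , forest , N[r]⊆ = Forest⇒Component r∉H forest N[r]⊆

  component : ∀ {H r} → r ∉ H → Component H r
  component = component′ _ ≤-refl

  record DetachedDPP (H : List V) (a b : V) : Set where
    field
      ps qs    : List V
      pathP    : AvoidingPath H a ps
      pathQ    : AvoidingPath H b qs
      disjoint : Unique ((a ∷ ps) ++ (b ∷ qs))
      maximalP : ∀ w → Adj A (lastOf a ps) w → w ∈ (a ∷ ps) ++ (b ∷ qs) ⊎ w ∈ H
      maximalQ : ∀ w → Adj A (lastOf b qs) w → w ∈ (a ∷ ps) ++ (b ∷ qs) ⊎ w ∈ H
      detached : inX (lastOf a ps) ≢ inX (lastOf b qs)

  DetachedDPP-∷ : ∀ {H a z b} → a ∉ H → Adj A a z → DetachedDPP (a ∷ H) z b → DetachedDPP H a b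
  DetachedDPP-∷ {H} {a} {z} {b} a∉H az D = record
    { ps = z ∷ ps
    ; qs = qs
    ; pathP = AvoidingPath-∷ a∉H az pathP
    ; pathQ = AvoidingPath-⊆ there pathQ
    ; disjoint = avoids⇒≢ (All-++⁺ (proj₂ (proj₂ pathP)) (proj₂ (proj₂ pathQ))) ∷ disjoint
    ; maximalP = λ w tw → absorb (maximalP w tw)
    ; maximalQ = λ w tw → absorb (maximalQ w tw)
    ; detached = detached }
    where
    open DetachedDPP D
    absorb : ∀ {w} → w ∈ (z ∷ ps) ++ (b ∷ qs) ⊎ w ∈ a ∷ H → w ∈ a ∷ (z ∷ ps) ++ (b ∷ qs) ⊎ w ∈ H
    absorb (inj₁ w∈D)         = inj₁ (there w∈D)
    absorb (inj₂ (here refl)) = inj₁ (here refl)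
    absorb (inj₂ (there w∈H)) = inj₂ w∈H

  terminus≢root : ∀ {H r ps w} → AvoidingPath H r ps → MaximalIn H r ps → Adj A r w → w ∉ H → lastOf r ps ≢ r
  terminus≢root {ps = []} _ maximal rw w∉H _ with maximal _ rw
  ... | inj₁ (here w≡r) = Adj-irrefl rw (sym w≡r)
  ... | inj₂ w∈H        = w∉H w∈H
  terminus≢root {ps = p ∷ ps} (_ , r∉path ∷ _ , _) _ _ _ t≡r = All.lookup r∉path (lastOf-∈ p ps) (sym t≡r)

  terminus-¬Adj-closed : ∀ {H a UB ps v} → Closed (a ∷ H) UB → AvoidingPath (UB ++ H) a ps →
                 lastOf a ps ≢ a → v ∈ UB → Adj A (lastOf a ps) v → ⊥
  terminus-¬Adj-closed {a = a} {UB} {ps} UB-closed (_ , _ , avoids) t≢a v∈UB tv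
    with UB-closed v∈UB (Adj-sym {lastOf a ps} tv)
  ... | inj₁ t∈UB         = All.lookup avoids (lastOf-∈ a ps) (∈-++⁺ˡ t∈UB)
  ... | inj₂ (here t≡a)   = t≢a t≡a
  ... | inj₂ (there t∈H)  = All.lookup avoids (lastOf-∈ a ps) (∈-++⁺ʳ UB t∈H)

  pairPaths : ∀ {H a b UB ps qs} → Closed (a ∷ H) UB → b ∈ UB →
              AvoidingPath (UB ++ H) a ps → MaximalIn (UB ++ H) a ps →
              (∀ {v} → v ∈ UB → Adj A (lastOf a ps) v → v ≡ b) →
              AvoidingPath (a ∷ H) b qs → MaximalIn (a ∷ H) b qs →
              inX (lastOf a ps) ≢ inX (lastOf b qs) → DetachedDPP H a b
  pairPaths {H} {a} {b} {UB} {ps} {qs} UB-closed b∈UB pathP@(_ , uniqueP , avoidsP) maximalP near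
            pathQ@(linkedQ , uniqueQ , _ ∷ avoidsQ) maximalQ detached = record
    { ps = ps
    ; qs = qs
    ; pathP = AvoidingPath-⊆ (xs⊆ys++xs H UB) pathP
    ; pathQ = AvoidingPath-⊆ there pathQ
    ; disjoint = Unique.++⁺ uniqueP uniqueQ λ (x∈P , x∈Q) → All.lookup avoidsP x∈P (∈-++⁺ˡ (Q⊆UB x∈Q))
    ; maximalP = maximalP′
    ; maximalQ = maximalQ′
    ; detached = detached }
    where
    Q⊆UB : b ∷ qs ⊆ UB
    Q⊆UB = walk⊆ UB-closed b∈UB linkedQ avoidsQ
    maximalP′ : ∀ w → Adj A (lastOf a ps) w → w ∈ (a ∷ ps) ++ (b ∷ qs) ⊎ w ∈ H
    maximalP′ w tw with maximalP w tw
    ... | inj₁ w∈P = inj₁ (∈-++⁺ˡ w∈P)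
    ... | inj₂ w∈UB++H with ∈-++⁻ UB w∈UB++H
    ...   | inj₁ w∈UB rewrite near w∈UB tw = inj₁ (∈-++⁺ʳ (a ∷ ps) (here refl))
    ...   | inj₂ w∈H = inj₂ w∈H
    maximalQ′ : ∀ w → Adj A (lastOf b qs) w → w ∈ (a ∷ ps) ++ (b ∷ qs) ⊎ w ∈ H
    maximalQ′ w tw with maximalQ w tw
    ... | inj₁ w∈Q         = inj₁ (∈-++⁺ʳ (a ∷ ps) w∈Q)
    ... | inj₂ (here refl) = inj₁ (here refl)
    ... | inj₂ (there w∈H) = inj₂ w∈H

  record TwoRoots (H : List V) (a b : V) : Set where
    field
      U          : List V
      unique     : Unique U
      a∈         : a ∈ U
      b∈         : b ∈ U
      avoids     : All (_∉ H) U
      closed     : Closed H U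
      dppOrHeavy : DetachedDPP H a b ⊎ ∃[ c ] Heavy c U (δ c (inX a) + δ c (inX b))

  pairComponents : ∀ {H a b} → (CB : Component (a ∷ H) b) → (CA : Component (U CB ++ H) a) →
                   (∀ {ps v} → AvoidingPath (U CB ++ H) a ps → MaximalIn (U CB ++ H) a ps →
                               v ∈ U CB → Adj A (lastOf a ps) v → v ≡ b) →
                   TwoRoots H a b
  pairComponents {H} {a} {b} CB CA near = record
    { U = U CA ++ U CB
    ; unique = Unique.++⁺ (Component.unique CA) (Component.unique CB)
                 λ (x∈A , x∈B) → All.lookup (Component.avoids CA) x∈A (∈-++⁺ˡ x∈B)
    ; a∈ = ∈-++⁺ˡ (Component.root∈ CA)
    ; b∈ = ∈-++⁺ʳ (U CA) (Component.root∈ CB)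
    ; avoids = All-++⁺ (avoids-⊆ (xs⊆ys++xs H (U CB)) (Component.avoids CA))
                       (avoids-⊆ there (Component.avoids CB))
    ; closed = Closed-++ (Component.closed CA) (Closed-⊆ a∷H⊆ (Component.closed CB))
    ; dppOrHeavy = dppOrHeavy }
    where
    a∷H⊆ : a ∷ H ⊆ U CA ++ H
    a∷H⊆ (here refl)  = ∈-++⁺ˡ (Component.root∈ CA)
    a∷H⊆ (there x∈H)  = ∈-++⁺ʳ (U CA) x∈H
    dppOrHeavy : DetachedDPP H a b ⊎ ∃[ c ] Heavy c (U CA ++ U CB) (δ c (inX a) + δ c (inX b))
    dppOrHeavy with opposite-or-common {P = MaxPath (U CB ++ H) a} {Q = MaxPath (a ∷ H) b}
                      (Component.maxPathOrHeavy CA) (Component.maxPathOrHeavy CB)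
                      (λ c → ¬Heavy-both c (inX a)) (λ c → ¬Heavy-both c (inX b))
    ... | inj₁ (e , (_ , pathP , maximalP , P-ends) , (_ , pathQ , maximalQ , Q-ends)) =
      inj₁ (pairPaths (Component.closed CB) (Component.root∈ CB) pathP maximalP (near pathP maximalP)
                      pathQ maximalQ λ same → not-¬ refl (trans (sym P-ends) (trans same Q-ends)))
    ... | inj₂ (c , A-heavy , B-heavy) = inj₂ (c , Heavy-++ A-heavy B-heavy)

  TwoRoots-∷ : ∀ {H a z b} → a ∉ H → Adj A a z → (R : TwoRoots (a ∷ H) z b) →
               (∀ {v} → Adj A a v → v ∈ TwoRoots.U R ⊎ v ∈ H) → TwoRoots H a b
  TwoRoots-∷ {a = a} {z} {b} a∉H az R N[a]⊆ = record
    { U = a ∷ U′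
    ; unique = avoids⇒≢ (TwoRoots.avoids R) ∷ TwoRoots.unique R
    ; a∈ = here refl
    ; b∈ = there (TwoRoots.b∈ R)
    ; avoids = a∉H ∷ avoids-⊆ there (TwoRoots.avoids R)
    ; closed = Closed-++ (λ { (here refl) av → inj₂ (Sum.[ ∈-++⁺ˡ , ∈-++⁺ʳ U′ ] (N[a]⊆ av)) })
                         (TwoRoots.closed R)
    ; dppOrHeavy = Sum.map (DetachedDPP-∷ a∉H az)
                           (λ (c , heavy′) → c , Heavy-∷ a (Heavy-weaken (≤-reflexive (reweigh c)) heavy′))
                           (TwoRoots.dppOrHeavy R) }
    where
    U′ : List V
    U′ = TwoRoots.U R
    reweigh : ∀ c → δ c (inX b) + δ c (not (inX a)) ≡ δ c (inX z) + δ c (inX b)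
    reweigh c = trans (+-comm (δ c (inX b)) _) (cong (λ i → δ c i + δ c (inX b)) (sym (Adj-flips {a} az)))

  twoRoots′ : ∀ k {H a b} → unvisited H ≤ k → a ∉ H → b ∉ H → a ≢ b → TwoRoots H a b
  twoRoots′ zero    H≤0 a∉H _ _ = ⊥-elim (unvisited-empty H≤0 a∉H)
  twoRoots′ (suc k) {H} {a} {b} H≤1+k a∉H b∉H a≢b
    with CB ← component (∉-∷ (a≢b ∘ sym) b∉H)
    with CA ← component (∉-++ (λ a∈UB → All.lookup (Component.avoids CB) a∈UB (here refl)) a∉H)
    with neighbour-outside? (U CB ++ H) a
  ... | inj₁ (w , aw , w∉) =
    pairComponents CB CA λ pathP maximalP v∈UB tv →
      ⊥-elim (terminus-¬Adj-closed (Component.closed CB) pathP (terminus≢root pathP maximalP aw w∉) v∈UB tv)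
  ... | inj₂ N[a]⊆UB++H with neighbour-outside? (b ∷ H) a
  ...   | inj₁ (z , az , z∉b∷H) = TwoRoots-∷ a∉H az R N[a]⊆U′
    where
    R : TwoRoots (a ∷ H) z b
    R = twoRoots′ k (≤-pred (≤-trans (unvisited-∷ a∉H) H≤1+k))
                  (∉-∷ (Adj-irrefl az ∘ sym) (z∉b∷H ∘ there)) (∉-∷ (a≢b ∘ sym) b∉H) (z∉b∷H ∘ here)
    N[a]⊆U′ : ∀ {v} → Adj A a v → v ∈ TwoRoots.U R ⊎ v ∈ H
    N[a]⊆U′ av with ∈-++⁻ (U CB) (N[a]⊆UB++H av)
    ... | inj₁ v∈UB = inj₁ (Component.least CB (TwoRoots.closed R) (TwoRoots.b∈ R) v∈UB)
    ... | inj₂ v∈H  = inj₂ v∈H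
  ...   | inj₂ N[a]⊆b∷H = pairComponents CB CA near
    where
    near : ∀ {ps v} → AvoidingPath (U CB ++ H) a ps → MaximalIn (U CB ++ H) a ps →
           v ∈ U CB → Adj A (lastOf a ps) v → v ≡ b
    near {ps} pathP _ v∈UB tv with lastOf a ps ≟ᵥ a
    ... | no t≢a    = ⊥-elim (terminus-¬Adj-closed (Component.closed CB) pathP t≢a v∈UB tv)
    ... | yes t≡a with N[a]⊆b∷H (subst (λ t → Adj A t _) t≡a tv)
    ...   | here v≡b  = v≡b
    ...   | there v∈H = ⊥-elim (All.lookup (Component.avoids CB) v∈UB (there v∈H))

  twoRoots : ∀ {H a b} → a ∉ H → b ∉ H → a ≢ b → TwoRoots H a b
  twoRoots = twoRoots′ _ ≤-refl

  complete : ∀ {U u} → Connected A → Closed [] U → u ∈ U → ∀ v → v ∈ U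
  complete {u = u} connected closed u∈U v with connected u v
  ... | ps , walk , refl = walk⊆ closed u∈U walk (All.tabulate λ _ ()) (lastOf-∈ u ps)

  order-bound : ∀ {ρ D t t′} → (∀ x y → ρ ≤ rho A x y) → Unique D → t ∈ D → t′ ∈ D →
                (∀ w → Adj A t w → w ∈ D) → (∀ w → Adj A t′ w → w ∈ D) → inX t ≢ inX t′ →
                ρ < length D
  order-bound {t = inj₁ x} {inj₂ y} ρ≤rho uniqueD t∈D _  N[t]⊆D N[t′]⊆D _ =
    ≤-<-trans (ρ≤rho x y) (rho<length A uniqueD t∈D N[t]⊆D N[t′]⊆D)
  order-bound {t = inj₂ y} {inj₁ x} ρ≤rho uniqueD _  t′∈D N[t]⊆D N[t′]⊆D _ =
    ≤-<-trans (ρ≤rho x y) (rho<length A uniqueD t′∈D N[t′]⊆D N[t]⊆D)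
  order-bound {t = inj₁ _} {inj₁ _} _ _ _ _ _ _ different = ⊥-elim (different refl)
  order-bound {t = inj₂ _} {inj₂ _} _ _ _ _ _ _ different = ⊥-elim (different refl)

  fromDetachedDPP : ∀ {ρ a b} → (∀ x y → ρ ≤ rho A x y) → DetachedDPP [] a b →
    ∃[ ps ] ∃[ qs ] (IsDPP A a b ps qs × IsMaximal A a b ps qs × IsDetached a b ps qs
                     × suc ρ ≤ order a b ps qs)
  fromDetachedDPP {a = a} {b} ρ≤rho D =
    ps , qs ,
    ((proj₁ pathP , proj₁ (proj₂ pathP)) , (proj₁ pathQ , proj₁ (proj₂ pathQ)) , disjoint) ,
    (N[t]⊆D , N[t′]⊆D) ,
    detached ,
    order-bound ρ≤rho disjoint (∈-++⁺ˡ (lastOf-∈ a ps)) (∈-++⁺ʳ (a ∷ ps) (lastOf-∈ b qs))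
                N[t]⊆D N[t′]⊆D detached
    where
    open DetachedDPP D
    N[t]⊆D : ∀ w → Adj A (lastOf a ps) w → w ∈ (a ∷ ps) ++ (b ∷ qs)
    N[t]⊆D w tw = Sum.[ id , (λ ()) ] (maximalP w tw)
    N[t′]⊆D : ∀ w → Adj A (lastOf b qs) w → w ∈ (a ∷ ps) ++ (b ∷ qs)
    N[t′]⊆D w tw = Sum.[ id , (λ ()) ] (maximalQ w tw)

lemma2p2 : (m : ℕ) (A : BipGraph m) → Connected A →
    (ρ : ℕ) → ((x y : Fin m) → ρ ≤ rho A x y) →
    (x₀ y₀ : Fin m) →
    ∃[ ps ] ∃[ qs ]
      (IsDPP A (inj₁ x₀) (inj₂ y₀) ps qs
       × IsMaximal A (inj₁ x₀) (inj₂ y₀) ps qs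
       × IsDetached (inj₁ x₀) (inj₂ y₀) ps qs
       × suc ρ ≤ order (inj₁ x₀) (inj₂ y₀) ps qs)
lemma2p2 m A connected ρ ρ≤rho x₀ y₀
  with R ← twoRoots A {[]} {inj₁ x₀} {inj₂ y₀} (λ ()) (λ ()) (λ ())
  with TwoRoots.dppOrHeavy R
... | inj₁ D              = fromDetachedDPP A ρ≤rho D
... | inj₂ (c , c-heavy)  =
  ⊥-elim (¬Heavy-complete (TwoRoots.unique R) all∈U c-heavy (≤-reflexive (sym (δ-opposite c))))
  where
  all∈U : ∀ v → v ∈ TwoRoots.U R
  all∈U = complete A connected (TwoRoots.closed R) (TwoRoots.a∈ R)
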